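{- Every finite non-empty word $W$ over a binary alphabet satisfies $r(W)=1$, i.e., $W$ has exactly one square-free reduct.
   Context: A square is a finite non-empty word of the form $XX$ with $X$ non-empty. A word is square-free if it contains no square as a factor (contiguous subword). If $W=UXXV$ with $X$ non-empty, replacing $W$ by $UXV$ is called a square reduction. A reduct (square-free reduct) of a finite word $W$ is any square-free word obtainable from $W$ by a finite sequence (possibly empty) of square reductions. $r(W)$ denotes the number of distinct reducts of $W$. -}

module Defs where

open import Data.Bool using (Bool)
open import Data.List using (List; []; _∷_; _++_)
open import Data.Product using (Σ; ∃; _×_; _,_)
open import Relation.Binary.PropositionalEquality using (_≡_)
open import Relation.Binary.Construct.Closure.ReflexiveTransitive using (Star)
open import Relation.Nullary using (¬_)
open import Data.Empty using (⊥)
open import Data.Unit using (⊤)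

Word : Set → Set
Word A = List A

NonEmpty : {A : Set} → Word A → Set
NonEmpty []      = ⊥
NonEmpty (_ ∷ _) = ⊤

HasSquare : {A : Set} → Word A → Set
HasSquare {A} W =
  Σ (Word A) λ U → Σ (Word A) λ X → Σ (Word A) λ V →
    NonEmpty X × (W ≡ U ++ X ++ X ++ V)

SquareFree : {A : Set} → Word A → Set
SquareFree W = ¬ HasSquare W

data _⟶_ {A : Set} : Word A → Word A → Set where
  reduce : (U X V : Word A) → NonEmpty X →
           (U ++ X ++ X ++ V) ⟶ (U ++ X ++ V)

_⟶*_ : {A : Set} → Word A → Word A → Set
_⟶*_ = Star _⟶_

IsReduct : {A : Set} → Word A → Word A → Set
IsReduct W R = (W ⟶* R) × SquareFree R

UniqueReduct : {A : Set} → Word A → Set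
UniqueReduct W = ∃ λ R → IsReduct W R × (∀ R' → IsReduct W R' → R' ≡ R)

-- Square reductions preserve the first letter, the last letter and the set of
-- letters occurring in a word: each is a morphism from (words, ++) into an
-- idempotent semigroup, and such morphisms cannot tell XX from X. Over {0,1}
-- the square-free words are ε, 0, 1, 01, 10, 010 and 101, and each is
-- determined by these data, so all reducts of a word coincide. Conversely,
-- prepending a letter to one of these words and reducing gives another one,
-- so every non-empty word has such a reduct.
module Submission where

open import Defs
open import Algebra.Bundles using (Band)
open import Algebra.Construct.Flip.Op as Flip using ()
open import Data.Bool using (Bool; true; false; not; _∨_)
open import Data.Bool.ListAction using (any)
open import Data.Bool.Properties using (∨-band; ∨-assoc; not-¬)
open import Data.Empty using (⊥-elim)
open import Data.List using ([]; _∷_; _++_; [_]; head; last; length)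
open import Data.List.Properties using (length-++-≤ʳ)
open import Data.List.Relation.Unary.Linked as Linked using (Linked; []; [-]; _∷_)
open import Data.Maybe using (Maybe; just; nothing; _<∣>_)
open import Data.Maybe.Properties using (<∣>-isSemigroup; <∣>-idem; <∣>-identityʳ)
open import Data.Nat using (_<_; _≤_; z≤n; s≤s)
open import Data.Nat.Properties using (≤-refl; ≤-trans; <⇒≱)
open import Data.Product using (∃; _×_; _,_)
open import Data.Unit using (tt)
open import Function using (id; _∘_)
open import Level using (0ℓ)
open import Relation.Binary.Construct.Closure.ReflexiveTransitive using (ε; _◅_; _◅◅_; gmap)
open import Relation.Binary.PropositionalEquality using (_≡_; _≢_; refl; sym; trans; cong; cong₂; module ≡-Reasoning)
open import Relation.Nullary using (¬_)

module _ {A : Set} where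

  squareAt : ∀ (U X V : Word A) → NonEmpty X → HasSquare (U ++ X ++ X ++ V)
  squareAt U X V X≢[] = U , X , V , X≢[] , refl

  squareReduction : ∀ (U X V : Word A) → NonEmpty X → (U ++ X ++ X ++ V) ⟶* (U ++ X ++ V)
  squareReduction U X V X≢[] = reduce U X V X≢[] ◅ ε

  ∷-⟶* : ∀ x {W W′ : Word A} → W ⟶* W′ → (x ∷ W) ⟶* (x ∷ W′)
  ∷-⟶* x = gmap (x ∷_) λ { (reduce U X V X≢[]) → reduce (x ∷ U) X V X≢[] }

  Invariant : {B : Set} → (Word A → B) → Set
  Invariant f = ∀ {W W′} → W ⟶ W′ → f W ≡ f W′

  invariant-⟶* : {B : Set} {f : Word A → B} → Invariant f →
                 ∀ {W W′} → W ⟶* W′ → f W ≡ f W′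
  invariant-⟶* inv ε        = refl
  invariant-⟶* inv (r ◅ rs) = trans (inv r) (invariant-⟶* inv rs)

  bandMorphism-invariant : ∀ {c ℓ} (S : Band c ℓ) → let open Band S in
                           (f : Word A → Carrier) →
                           (∀ xs ys → f (xs ++ ys) ≈ f xs ∙ f ys) →
                           ∀ {W W′} → W ⟶ W′ → f W ≈ f W′
  bandMorphism-invariant S f homo (reduce U X V _) = begin
    f (U ++ X ++ X ++ V)          ≈⟨ homo U _ ⟩
    f U ∙ f (X ++ X ++ V)         ≈⟨ ∙-congˡ (homo X _) ⟩
    f U ∙ (f X ∙ f (X ++ V))      ≈⟨ ∙-congˡ (∙-congˡ (homo X V)) ⟩
    f U ∙ (f X ∙ (f X ∙ f V))     ≈⟨ ∙-congˡ (assoc _ _ _) ⟨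
    f U ∙ ((f X ∙ f X) ∙ f V)     ≈⟨ ∙-congˡ (∙-congʳ (idem (f X))) ⟩
    f U ∙ (f X ∙ f V)             ≈⟨ ∙-congˡ (homo X V) ⟨
    f U ∙ f (X ++ V)              ≈⟨ homo U _ ⟨
    f (U ++ X ++ V)               ∎
    where open Band S using (_≈_; _∙_; assoc; idem; ∙-congˡ; ∙-congʳ; setoid)
          open import Relation.Binary.Reasoning.Setoid setoid

  head-++ : ∀ (xs ys : Word A) → head (xs ++ ys) ≡ head xs <∣> head ys
  head-++ []       ys = refl
  head-++ (x ∷ xs) ys = refl

  last-∷-<∣> : ∀ (x : A) xs m → last (x ∷ xs) <∣> m ≡ last (x ∷ xs)
  last-∷-<∣> x []       m = refl
  last-∷-<∣> x (y ∷ xs) m = last-∷-<∣> y xs m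

  last-++ : ∀ (xs ys : Word A) → last (xs ++ ys) ≡ last ys <∣> last xs
  last-++ []           ys       = sym (<∣>-identityʳ (last ys))
  last-++ (x ∷ [])     []       = refl
  last-++ (x ∷ [])     (y ∷ ys) = sym (last-∷-<∣> y ys (just x))
  last-++ (x ∷ y ∷ xs) ys       = last-++ (y ∷ xs) ys

  any-++ : ∀ (p : A → Bool) xs ys → any p (xs ++ ys) ≡ any p xs ∨ any p ys
  any-++ p []       ys = refl
  any-++ p (x ∷ xs) ys = trans (cong (p x ∨_) (any-++ p xs ys)) (sym (∨-assoc (p x) _ _))

  <∣>-band : Band 0ℓ 0ℓ
  <∣>-band = record { isBand = record { isSemigroup = <∣>-isSemigroup A ; idem = <∣>-idem } }

  head-invariant : Invariant head
  head-invariant = bandMorphism-invariant <∣>-band head head-++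

  last-invariant : Invariant last
  last-invariant = bandMorphism-invariant (Flip.band <∣>-band) last last-++

  any-invariant : ∀ p → Invariant (any p)
  any-invariant p = bandMorphism-invariant ∨-band (any p) (any-++ p)

  ¬linked-≢-repeat : ∀ U {x : A} V → ¬ Linked _≢_ (U ++ x ∷ x ∷ V)
  ¬linked-≢-repeat []      V (x≢x ∷ _) = x≢x refl
  ¬linked-≢-repeat (u ∷ U) V linked    = ¬linked-≢-repeat U V (Linked.tail linked)

  length-long-square : ∀ U (x y : A) X V → 4 ≤ length (U ++ (x ∷ y ∷ X) ++ (x ∷ y ∷ X) ++ V)
  length-long-square U x y X V =
    ≤-trans (s≤s (s≤s (≤-trans (s≤s (s≤s z≤n)) (length-++-≤ʳ (x ∷ y ∷ X ++ V) {X}))))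
            (length-++-≤ʳ _ {U})

  linked-≢-squareFree : ∀ {W : Word A} → Linked _≢_ W → length W < 4 → SquareFree W
  linked-≢-squareFree linked short (U , x ∷ []     , V , _ , refl) = ¬linked-≢-repeat U V linked
  linked-≢-squareFree linked short (U , x ∷ y ∷ X , V , _ , refl) =
    <⇒≱ short (length-long-square U x y X V)

data Canonical : Word Bool → Set where
  single : ∀ x → Canonical [ x ]
  pair   : ∀ x → Canonical (x ∷ not x ∷ [])
  triple : ∀ x → Canonical (x ∷ not x ∷ x ∷ [])

canonical-squareFree : ∀ {W} → Canonical W → SquareFree W
canonical-squareFree (single x) = linked-≢-squareFree [-] (s≤s (s≤s z≤n))
canonical-squareFree (pair x)   = linked-≢-squareFree (not-¬ refl ∷ [-]) (s≤s (s≤s (s≤s z≤n)))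
canonical-squareFree (triple x) = linked-≢-squareFree (not-¬ refl ∷ not-¬ refl ∘ sym ∷ [-]) ≤-refl

∷-canonical : ∀ x {N} → Canonical N → ∃ λ M → (x ∷ N) ⟶* M × Canonical M
∷-canonical true  (single true)  = _ , squareReduction [] [ true ] [] tt , single true
∷-canonical true  (single false) = _ , ε , pair true
∷-canonical true  (pair true)    = _ , squareReduction [] [ true ] [ false ] tt , pair true
∷-canonical true  (pair false)   = _ , ε , triple true
∷-canonical true  (triple true)  = _ , squareReduction [] [ true ] (false ∷ true ∷ []) tt , triple true
∷-canonical true  (triple false) = _ , squareReduction [] (true ∷ false ∷ []) [] tt , pair true
∷-canonical false (single false) = _ , squareReduction [] [ false ] [] tt , single false
∷-canonical false (single true)  = _ , ε , pair false
∷-canonical false (pair false)   = _ , squareReduction [] [ false ] [ true ] tt , pair false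
∷-canonical false (pair true)    = _ , ε , triple false
∷-canonical false (triple false) = _ , squareReduction [] [ false ] (true ∷ false ∷ []) tt , triple false
∷-canonical false (triple true)  = _ , squareReduction [] (false ∷ true ∷ []) [] tt , pair false

canonicalReduct : ∀ x W → ∃ λ N → (x ∷ W) ⟶* N × Canonical N
canonicalReduct x []      = _ , ε , single x
canonicalReduct x (y ∷ W) =
  let N , y∷W⟶*N , canN = canonicalReduct y W
      M , x∷N⟶*M , canM = ∷-canonical x canN
  in  M , ∷-⟶* x y∷W⟶*N ◅◅ x∷N⟶*M , canM

Signature : Set
Signature = Maybe Bool × Maybe Bool × Bool × Bool

signature : Word Bool → Signature
signature W = head W , last W , any id W , any not W

signature-invariant : Invariant signature
signature-invariant r =
  cong₂ _,_ (head-invariant r)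
    (cong₂ _,_ (last-invariant r) (cong₂ _,_ (any-invariant id r) (any-invariant not r)))

reductOf : Signature → Word Bool
reductOf (just true  , just false , _)           = true ∷ false ∷ []
reductOf (just false , just true  , _)           = false ∷ true ∷ []
reductOf (just x     , _          , true , true) = x ∷ not x ∷ x ∷ []
reductOf (just x     , _          , _)           = [ x ]
reductOf (nothing    , _)                        = []

squareFree-reductOf-signature : ∀ {R} → SquareFree R → R ≡ reductOf (signature R)
squareFree-reductOf-signature {[]}                         _  = refl
squareFree-reductOf-signature {true ∷ []}                  _  = refl
squareFree-reductOf-signature {false ∷ []}                 _  = refl
squareFree-reductOf-signature {true ∷ true ∷ R}            sf = ⊥-elim (sf (squareAt [] [ true ] R tt))
squareFree-reductOf-signature {false ∷ false ∷ R}          sf = ⊥-elim (sf (squareAt [] [ false ] R tt))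
squareFree-reductOf-signature {true ∷ false ∷ []}          _  = refl
squareFree-reductOf-signature {false ∷ true ∷ []}          _  = refl
squareFree-reductOf-signature {true ∷ false ∷ false ∷ R}   sf = ⊥-elim (sf (squareAt [ true ] [ false ] R tt))
squareFree-reductOf-signature {false ∷ true ∷ true ∷ R}    sf = ⊥-elim (sf (squareAt [ false ] [ true ] R tt))
squareFree-reductOf-signature {true ∷ false ∷ true ∷ []}   _  = refl
squareFree-reductOf-signature {false ∷ true ∷ false ∷ []}  _  = refl
squareFree-reductOf-signature {true ∷ false ∷ true ∷ true ∷ R} sf =
  ⊥-elim (sf (squareAt (true ∷ false ∷ []) [ true ] R tt))
squareFree-reductOf-signature {false ∷ true ∷ false ∷ false ∷ R} sf =
  ⊥-elim (sf (squareAt (false ∷ true ∷ []) [ false ] R tt))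
squareFree-reductOf-signature {true ∷ false ∷ true ∷ false ∷ R} sf =
  ⊥-elim (sf (squareAt [] (true ∷ false ∷ []) R tt))
squareFree-reductOf-signature {false ∷ true ∷ false ∷ true ∷ R} sf =
  ⊥-elim (sf (squareAt [] (false ∷ true ∷ []) R tt))

squareFree-reduct-unique : ∀ {W R R′ : Word Bool} → W ⟶* R → W ⟶* R′ →
                           SquareFree R → SquareFree R′ → R ≡ R′
squareFree-reduct-unique {W} {R} {R′} W⟶*R W⟶*R′ sfR sfR′ = begin
  R                         ≡⟨ squareFree-reductOf-signature sfR ⟩
  reductOf (signature R)    ≡⟨ cong reductOf (invariant-⟶* signature-invariant W⟶*R) ⟨
  reductOf (signature W)    ≡⟨ cong reductOf (invariant-⟶* signature-invariant W⟶*R′) ⟩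
  reductOf (signature R′)   ≡⟨ squareFree-reductOf-signature sfR′ ⟨
  R′                        ∎
  where open ≡-Reasoning

proposition2p1 : (W : Word Bool) → NonEmpty W → UniqueReduct W
proposition2p1 (x ∷ W) _ =
  let N , x∷W⟶*N , canN = canonicalReduct x W
      sfN               = canonical-squareFree canN
  in  N , (x∷W⟶*N , sfN) , λ R (x∷W⟶*R , sfR) → squareFree-reduct-unique x∷W⟶*R x∷W⟶*N sfR sfN
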